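{- Let $T$ be a p-string of length $n$ over $\Sigma \cup \Pi$ (terminating with the unique end-marker $\$$), and let $\sigma$ and $\pi$ be the numbers of distinct characters of $\Sigma$ and of $\Pi$, respectively, occurring in $T$. Then the number of branching p-nodes in the parameterized suffix tree $\mathsf{PSTree}(T)$ is $O\!\left(\frac{n}{\pi+\sigma}\right)$.
   Context: $\Sigma$ (static alphabet) and $\Pi$ (parameterized alphabet) are disjoint ordered alphabets; a p-string is a string over $\Sigma\cup\Pi$. Every character of $\Pi$ is smaller than every character of $\Sigma$. The text $T$ ends with a special character $\$\in\Sigma$ occurring nowhere else in $T$ and larger than all other characters. For a p-string $w$, the previous encoding $\mathrm{prev}(w)$ is the string of length $|w|$ with $\mathrm{prev}(w)[i]=w[i]$ if $w[i]\in\Sigma$; $\mathrm{prev}(w)[i]=0$ if $w[i]\in\Pi$ and $w[i]$ does not occur in $w[1..i-1]$; and otherwise $\mathrm{prev}(w)[i]=i-j$ where $j<i$ is the largest index with $w[j]=w[i]$. The parameterized suffix tree $\mathsf{PSTree}(T)$ is the compacted trie of the set $\{\mathrm{prev}(T[i..|T|]) : 1\le i\le |T|\}$; it has one leaf per suffix of $T$. Let $\Sigma_T,\Pi_T$ be the sets of characters of $\Sigma$, resp. $\Pi$, occurring in $T$, $\sigma=|\Sigma_T|$, $\pi=|\Pi_T|$. A node $v$ of $\mathsf{PSTree}(T)$ is a p-node if the subtree rooted at $v$ has at least $\max\{\sigma,\pi\}$ leaves; a p-node is a branching p-node if at least two of its children in $\mathsf{PSTree}(T)$ are p-nodes. -}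

module Defs where

open import Data.Nat using (ℕ; zero; suc; _+_; _*_; _≤_; _<_; _⊔_)
open import Data.Nat.Properties using (_≟_)
open import Data.Bool using (Bool; true; false; if_then_else_)
open import Data.Maybe using (Maybe; just; nothing)
open import Data.Sum using (_⊎_; inj₁; inj₂)
open import Data.Sum.Properties using (≡-dec)
open import Data.Product using (Σ; ∃; ∃₂; _×_; _,_)
open import Data.List using (List; []; _∷_; _++_; [_]; length; drop; filter; map; mapMaybe; deduplicate; upTo)
open import Data.List.Membership.Propositional using (_∈_)
open import Data.List.Relation.Unary.Any using (Any)
open import Data.List.Relation.Binary.Prefix.Heterogeneous using (Prefix)
open import Data.List.Relation.Binary.Prefix.Heterogeneous.Properties using (prefix?)
open import Relation.Binary.PropositionalEquality using (_≡_; _≢_)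
open import Relation.Binary.Definitions using (DecidableEquality)
open import Relation.Nullary using (¬_)

-- Characters of a p-string: inj₁ s is the static character s ∈ Σ,
-- inj₂ p is the parameterized character p ∈ Π.  (Σ and Π are disjoint copies of ℕ.)
Char : Set
Char = ℕ ⊎ ℕ

PString : Set
PString = List Char

-- Characters of prev-encoded strings: inj₁ s is a static character,
-- inj₂ k is the number k (0 or a backward distance) encoding a parameterized character.
PChar : Set
PChar = ℕ ⊎ ℕ

_≟c_ : DecidableEquality PChar
_≟c_ = ≡-dec _≟_ _≟_

-- distance to the most recent previous occurrence of the Π-character p,
-- given the already-read characters in reverse order (most recent first);
-- nothing if p does not occur there.
lastDist : ℕ → List Char → Maybe ℕ
lastDist p [] = nothing
lastDist p (inj₁ _ ∷ xs) with lastDist p xs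
... | just k  = just (suc k)
... | nothing = nothing
lastDist p (inj₂ q ∷ xs) with p ≟ q
... | Relation.Nullary.yes _ = just 1
... | Relation.Nullary.no _ with lastDist p xs
...   | just k  = just (suc k)
...   | nothing = nothing

prevAux : List Char → PString → List PChar
prevAux seen [] = []
prevAux seen (inj₁ s ∷ w) = inj₁ s ∷ prevAux (inj₁ s ∷ seen) w
prevAux seen (inj₂ p ∷ w) with lastDist p seen
... | just k  = inj₂ k ∷ prevAux (inj₂ p ∷ seen) w
... | nothing = inj₂ 0 ∷ prevAux (inj₂ p ∷ seen) w

prev : PString → List PChar
prev w = prevAux [] w

staticChars : PString → List ℕ
staticChars = mapMaybe (λ { (inj₁ s) → just s ; (inj₂ _) → nothing })

paramChars : PString → List ℕ
paramChars = mapMaybe (λ { (inj₁ _) → nothing ; (inj₂ p) → just p })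

sigma : PString → ℕ
sigma T = length (deduplicate _≟_ (staticChars T))

pi : PString → ℕ
pi T = length (deduplicate _≟_ (paramChars T))

_⊑_ : List PChar → List PChar → Set
x ⊑ y = Prefix _≡_ x y

-- the encoded suffixes prev(T[i..|T|]), 1 ≤ i ≤ |T| (0-based i < |T| here)
encSuffix : PString → ℕ → List PChar
encSuffix T i = prev (drop i T)

encSuffixes : PString → List (List PChar)
encSuffixes T = map (encSuffix T) (upTo (length T))

-- x is the path label of a locus (possibly implicit) of the trie of the encoded suffixes
IsLocus : PString → List PChar → Set
IsLocus T x = Any (λ s → x ⊑ s) (encSuffixes T)

-- Explicit nodes of the compacted trie PSTree(T): the root, the leaves
-- (the encoded suffixes), and every locus having at least two distinct
-- outgoing characters.  A node is identified with its path label.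
IsNode : PString → List PChar → Set
IsNode T x =
  x ≡ []
  ⊎ x ∈ encSuffixes T
  ⊎ (∃₂ λ a b → a ≢ b × IsLocus T (x ++ [ a ]) × IsLocus T (x ++ [ b ]))

IsChild : PString → List PChar → List PChar → Set
IsChild T x y =
  IsNode T x × IsNode T y × x ⊑ y × x ≢ y
  × (∀ z → IsNode T z → x ⊑ z → z ⊑ y → z ≡ x ⊎ z ≡ y)

-- number of leaves in the subtree rooted at (the node labelled) x:
-- the number of suffixes whose encoding has x as a prefix
leafCount : PString → List PChar → ℕ
leafCount T x = length (filter (λ s → prefix? _≟c_ x s) (encSuffixes T))

IsPNode : PString → List PChar → Set
IsPNode T x = IsNode T x × sigma T ⊔ pi T ≤ leafCount T x

IsBranchingPNode : PString → List PChar → Set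
IsBranchingPNode T x =
  IsPNode T x
  × (∃₂ λ y z → y ≢ z × IsChild T x y × IsChild T x z × IsPNode T y × IsPNode T z)

-- The two p-node children of a branching p-node x begin with distinct
-- characters a ≠ b, so x·a and x·b each prefix at least m = max{σ, π} encoded
-- suffixes: x carries a heavy fork.  In any multiset S of words at most |S|/m
-- distinct words carry a heavy fork: splitting S by first character, strong
-- induction on the size of S gives  ℓ·m + min(m, |S|) ≤ |S|,  since a heavy
-- fork at the root leaves two heavy subtries.  As 2m ≥ σ + π and there are n
-- suffixes, ℓ·(σ + π) ≤ 2n.
module Submission where

open import Defs
open import Data.Nat using (ℕ; _+_; _*_; _≤_; _<_)
open import Data.Sum using (inj₁)
open import Data.Product using (∃)
open import Data.List using (List; _++_; [_]; length)
open import Data.List.Membership.Propositional using (_∈_; _∉_)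
open import Data.List.Relation.Unary.All using (All)
open import Data.List.Relation.Unary.Unique.Propositional using (Unique)

open import Data.Nat using (zero; suc; _⊓_; _⊔_; s≤s; z≤n; NonZero; >-nonZero⁻¹)
open import Data.Nat.Properties
open import Data.Nat.Induction using (<-wellFounded)
open import Data.Nat.Tactic.RingSolver using (solve-∀)
open import Induction.WellFounded using (Acc; acc)
open import Data.Empty using (⊥-elim)
open import Data.Sum as Sum using (_⊎_; inj₂; [_,_]′)
open import Data.Product as Product using (_×_; _,_; ∃₂)
open import Data.List using ([]; _∷_; filter; upTo)
import Data.List.Properties as List
open import Data.List.Properties
  using (≡-dec; filter-accept; filter-reject; filter-all; length-filter; length-map; length-upTo;
         ++-identityʳ-unique; ++-cancelˡ; ∷-injectiveʳ)
open import Data.List.Relation.Unary.All using ([]; _∷_)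
import Data.List.Relation.Unary.All as All
open import Data.List.Relation.Unary.All.Properties using (all-filter)
import Data.List.Relation.Unary.All.Properties as Allₚ
import Data.List.Relation.Unary.Any as Any
open import Data.List.Relation.Unary.AllPairs using ([]; _∷_)
import Data.List.Relation.Unary.Unique.Propositional.Properties as Unique
import Data.List.Relation.Binary.Pointwise as Pointwise
open import Data.List.Relation.Binary.Prefix.Heterogeneous using ([]; _∷_; _++ᵖ_)
open import Data.List.Relation.Binary.Prefix.Heterogeneous.Properties using (prefix?; fromPointwise; ++⁺)
import Data.List.Relation.Binary.Prefix.Heterogeneous.Properties as Prefix
open import Data.List.Relation.Binary.Sublist.Heterogeneous.Properties using (length-mono-≤; ⊆-filter-Sublist)
open import Data.List.Relation.Binary.Sublist.Propositional using (⊆-refl)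
open import Function using (_∘_; id; case_of_)
open import Relation.Binary.PropositionalEquality using (_≡_; _≢_; refl; sym; cong; cong₂; subst; ≢-sym)
import Relation.Binary.PropositionalEquality as ≡
open import Relation.Binary.Definitions using (DecidableEquality)
open import Relation.Nullary using (¬_; Dec; yes; no; ¬?)
open import Relation.Unary using (Decidable; _⊆_)

Word : Set
Word = List PChar

_≟w_ : DecidableEquality Word
_≟w_ = ≡-dec _≟c_

NonEmpty : Word → Set
NonEmpty x = x ≢ []

++-∷-nonEmpty : ∀ (x : Word) a r → NonEmpty (x ++ a ∷ r)
++-∷-nonEmpty []      a r ()
++-∷-nonEmpty (_ ∷ x) a r ()

++-∷-≢ : ∀ (x : Word) a r → x ++ a ∷ r ≢ x
++-∷-≢ x a r eq = case ++-identityʳ-unique x (sym eq) of λ ()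

⊑-refl : {x : Word} → x ⊑ x
⊑-refl = fromPointwise (Pointwise.refl refl)

⊑-trans : {x y z : Word} → x ⊑ y → y ⊑ z → x ⊑ z
⊑-trans = Prefix.trans ≡.trans

x⊑x++y : (x y : Word) → x ⊑ (x ++ y)
x⊑x++y x y = ⊑-refl ++ᵖ y

++⁺-⊑ : (x : Word) {u v : Word} → u ⊑ v → (x ++ u) ⊑ (x ++ v)
++⁺-⊑ x = ++⁺ (Pointwise.refl refl)

filter-absorbs : ∀ {A : Set} {P Q : A → Set} (P? : Decidable P) (Q? : Decidable Q) →
                 P ⊆ Q → ∀ xs → filter P? (filter Q? xs) ≡ filter P? xs
filter-absorbs P? Q? P⊆Q [] = refl
filter-absorbs P? Q? P⊆Q (x ∷ xs) with Q? x
... | no ¬qx rewrite filter-reject P? {xs = xs} (¬qx ∘ P⊆Q) = filter-absorbs P? Q? P⊆Q xs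
... | yes _ with P? x
...   | yes _ = cong (x ∷_) (filter-absorbs P? Q? P⊆Q xs)
...   | no _  = filter-absorbs P? Q? P⊆Q xs

⊓-subadditive : ∀ m a b → m ⊓ (a + b) ≤ m ⊓ a + m ⊓ b
⊓-subadditive m a b with ⊓-sel m a | ⊓-sel m b
... | inj₁ eq | _       rewrite eq = ≤-trans (m⊓n≤m m (a + b)) (m≤m+n m (m ⊓ b))
... | inj₂ _  | inj₁ eq rewrite eq = ≤-trans (m⊓n≤m m (a + b)) (m≤n+m m (m ⊓ a))
... | inj₂ ea | inj₂ eb rewrite ea | eb = m⊓n≤n m (a + b)

suc-*-+ : ∀ ℓ m → suc ℓ * m + m ≡ ℓ * m + (m + m)
suc-*-+ = solve-∀

+-*-interchange : ∀ a b m u v → (a + b) * m + (u + v) ≡ (a * m + u) + (b * m + v)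
+-*-interchange = solve-∀

count : Word → List Word → ℕ
count p S = length (filter (prefix? _≟c_ p) S)

count-accept : ∀ {p} s S → p ⊑ s → count p (s ∷ S) ≡ suc (count p S)
count-accept {p} s S p⊑s = cong length (filter-accept (prefix? _≟c_ p) {xs = S} p⊑s)

count-reject : ∀ {p} s S → ¬ p ⊑ s → count p (s ∷ S) ≡ count p S
count-reject {p} s S p⋢s = cong length (filter-reject (prefix? _≟c_ p) {xs = S} p⋢s)

count-[] : ∀ S → count [] S ≡ length S
count-[] S = cong length (filter-all (prefix? _≟c_ []) (All.universal (λ _ → []) S))

count≤length : ∀ p S → count p S ≤ length S
count≤length p = length-filter (prefix? _≟c_ p)

count-antitone : ∀ {p q} S → p ⊑ q → count q S ≤ count p S
count-antitone {p} {q} S p⊑q = length-mono-≤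
  (⊆-filter-Sublist (prefix? _≟c_ q) (prefix? _≟c_ p) (λ { refl → ⊑-trans p⊑q }) (⊆-refl {x = S}))

under : PChar → List Word → List Word
under c [] = []
under c ([] ∷ S) = under c S
under c ((a ∷ s) ∷ S) with a ≟c c
... | yes _ = s ∷ under c S
... | no  _ = under c S

notStartingWith? : ∀ c → Decidable (λ s → ¬ [ c ] ⊑ s)
notStartingWith? c = ¬? ∘ prefix? _≟c_ [ c ]

outside : PChar → List Word → List Word
outside c = filter (notStartingWith? c)

outside-drops : ∀ c s S → outside c ((c ∷ s) ∷ S) ≡ outside c S
outside-drops c s S = filter-reject (notStartingWith? c) {xs = S} (λ c⋢ → c⋢ (refl ∷ []))

outside-keeps : ∀ {c a} s S → a ≢ c → outside c ((a ∷ s) ∷ S) ≡ (a ∷ s) ∷ outside c S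
outside-keeps {c} s S a≢c =
  filter-accept (notStartingWith? c) {xs = S} λ { (c≡a ∷ []) → a≢c (sym c≡a) }

length-under+outside : ∀ c S → length (under c S) + length (outside c S) ≡ length S
length-under+outside c [] = refl
length-under+outside c ([] ∷ S) =
  ≡.trans (+-suc _ _) (cong suc (length-under+outside c S))
length-under+outside c ((a ∷ s) ∷ S) with a ≟c c
... | yes refl rewrite outside-drops a s S = cong suc (length-under+outside a S)
... | no a≢c rewrite outside-keeps s S a≢c =
  ≡.trans (+-suc _ _) (cong suc (length-under+outside c S))

count-under : ∀ c p S → count p (under c S) ≡ count (c ∷ p) S
count-under c p [] = refl
count-under c p ([] ∷ S) = count-under c p S
count-under c p ((a ∷ s) ∷ S) with a ≟c c
... | no a≢c = ≡.trans (count-under c p S)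
                  (sym (count-reject (a ∷ s) S λ { (c≡a ∷ _) → a≢c (sym c≡a) }))
... | yes refl = cases (prefix? _≟c_ p s)
  where
  cases : Dec (p ⊑ s) → count p (s ∷ under a S) ≡ count (a ∷ p) ((a ∷ s) ∷ S)
  cases (yes p⊑s) = ≡.trans (count-accept s (under a S) p⊑s)
    (≡.trans (cong suc (count-under a p S)) (sym (count-accept (a ∷ s) S (refl ∷ p⊑s))))
  cases (no p⋢s) = ≡.trans (count-reject s (under a S) p⋢s)
    (≡.trans (count-under a p S) (sym (count-reject (a ∷ s) S λ { (_ ∷ p⊑s) → p⋢s p⊑s })))

count-outside : ∀ {a c} p S → a ≢ c → count (a ∷ p) (outside c S) ≡ count (a ∷ p) S
count-outside {a} {c} p S a≢c = cong length
  (filter-absorbs (prefix? _≟c_ (a ∷ p)) (notStartingWith? c)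
    (λ { (refl ∷ _) (c≡a ∷ []) → a≢c (sym c≡a) }) S)

size : List Word → ℕ
size [] = 0
size (s ∷ S) = suc (length s) + size S

size-under : ∀ c S → size (under c S) + length (under c S) ≤ size S
size-under c [] = z≤n
size-under c ([] ∷ S) = m≤n⇒m≤1+n (size-under c S)
size-under c ((a ∷ s) ∷ S) with a ≟c c
... | no _ = ≤-trans (size-under c S) (m≤n+m (size S) (suc (suc (length s))))
... | yes _ = begin
  suc (length s) + size U + suc (length U)    ≡⟨ +-suc _ (length U) ⟩
  suc (suc (length s) + size U + length U)    ≡⟨ cong suc (+-assoc (suc (length s)) _ _) ⟩
  suc (suc (length s) + (size U + length U))  ≤⟨ s≤s (+-monoʳ-≤ (suc (length s)) (size-under c S)) ⟩
  suc (suc (length s) + size S)               ∎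
  where
  open ≤-Reasoning
  U = under c S

size-outside : ∀ c S → size (outside c S) + length (under c S) ≤ size S
size-outside c [] = z≤n
size-outside c ([] ∷ S) = s≤s (size-outside c S)
size-outside c ((a ∷ s) ∷ S) with a ≟c c
... | yes refl rewrite outside-drops a s S =
  ≤-trans (≤-reflexive (+-suc _ _)) (s≤s (≤-trans (size-outside a S) (m≤n+m (size S) (suc (length s)))))
... | no a≢c rewrite outside-keeps s S a≢c =
  ≤-trans (≤-reflexive (+-assoc (suc (suc (length s))) _ _))
          (+-monoʳ-≤ (suc (suc (length s))) (size-outside c S))

size-under-< : ∀ c S → 1 ≤ length (under c S) → size (under c S) < size S
size-under-< c S occ = <-≤-trans (m<m+n _ occ) (size-under c S)

size-outside-< : ∀ c S → 1 ≤ length (under c S) → size (outside c S) < size S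
size-outside-< c S occ = <-≤-trans (m<m+n _ occ) (size-outside c S)

All-under : ∀ {P Q : Word → Set} c {L} → (∀ {x} → P (c ∷ x) → Q x) → All P L → All Q (under c L)
All-under c f [] = []
All-under c {[] ∷ L} f (_ ∷ ps) = All-under c f ps
All-under c {(a ∷ x) ∷ L} f (p ∷ ps) with a ≟c c
... | yes refl = f p ∷ All-under c f ps
... | no _     = All-under c f ps

Unique-under : ∀ c {L} → Unique L → Unique (under c L)
Unique-under c [] = []
Unique-under c {[] ∷ L} (_ ∷ u) = Unique-under c u
Unique-under c {(a ∷ x) ∷ L} (x∉ ∷ u) with a ≟c c
... | yes refl = All-under a (λ ne eq → ne (cong (a ∷_) eq)) x∉ ∷ Unique-under c u
... | no _     = Unique-under c u

Unique-outside : ∀ c {L} → Unique L → Unique (outside c L)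
Unique-outside c = Unique.filter⁺ (notStartingWith? c)

All-outside : ∀ {P Q : Word → Set} c {L} → (∀ {a x} → a ≢ c → P (a ∷ x) → Q (a ∷ x)) →
              All NonEmpty L → All P L → All Q (outside c L)
All-outside {P} {Q} c {L} f ne ps =
  All.zipWith step (all-filter (notStartingWith? c) L , Allₚ.filter⁺ (notStartingWith? c) (All.zip (ne , ps)))
  where
  step : ∀ {x} → ¬ [ c ] ⊑ x × NonEmpty x × P x → Q x
  step {[]}    (_ , ne , _) = ⊥-elim (ne refl)
  step {a ∷ x} (c⋢ , _ , p) = f (λ { refl → c⋢ (refl ∷ []) }) p

HeavyFork : ℕ → List Word → Word → Set
HeavyFork m S x = ∃₂ λ a b → a ≢ b × m ≤ count (x ++ [ a ]) S × m ≤ count (x ++ [ b ]) S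

HeavyFork-under : ∀ {m} c S {x} → HeavyFork m S (c ∷ x) → HeavyFork m (under c S) x
HeavyFork-under {m} c S {x} (a , b , a≢b , ma , mb) =
  a , b , a≢b , subst (m ≤_) (sym (count-under c (x ++ [ a ]) S)) ma
              , subst (m ≤_) (sym (count-under c (x ++ [ b ]) S)) mb

HeavyFork-outside : ∀ {m c a} S {x} → a ≢ c → HeavyFork m S (a ∷ x) → HeavyFork m (outside c S) (a ∷ x)
HeavyFork-outside {m} S {x} a≢c (a , b , a≢b , ma , mb) =
  a , b , a≢b , subst (m ≤_) (sym (count-outside (x ++ [ a ]) S a≢c)) ma
              , subst (m ≤_) (sym (count-outside (x ++ [ b ]) S a≢c)) mb

dropRoot : List Word → List Word
dropRoot = filter (λ x → ¬? (x ≟w []))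

length-dropRoot : ∀ {P : Word → Set} {L} → Unique L → All P L →
                  length L ≡ length (dropRoot L) ⊎ P [] × length L ≡ suc (length (dropRoot L))
length-dropRoot [] [] = inj₁ refl
length-dropRoot {L = [] ∷ L} ([]∉L ∷ _) (p ∷ _) =
  inj₂ (p , cong suc (sym (cong length (filter-all (λ x → ¬? (x ≟w [])) (All.map ≢-sym []∉L)))))
length-dropRoot {L = (_ ∷ _) ∷ L} (_ ∷ u) (_ ∷ ps) =
  Sum.map (cong suc) (Product.map₂ (cong suc)) (length-dropRoot u ps)

module _ (m : ℕ) .{{_ : NonZero m}} where

  private
    heavy⇒occupied : ∀ {c x} S → HeavyFork m S (c ∷ x) → 1 ≤ length (under c S)
    heavy⇒occupied {c} {x} S (a , _ , _ , ma , _) = begin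
      1                           ≤⟨ >-nonZero⁻¹ m ⟩
      m                           ≤⟨ ma ⟩
      count (c ∷ x ++ [ a ]) S    ≤⟨ count-antitone S (refl ∷ []) ⟩
      count [ c ] S               ≡⟨ sym (count-under c [] S) ⟩
      count [] (under c S)        ≡⟨ count-[] (under c S) ⟩
      length (under c S)          ∎
      where open ≤-Reasoning

  mutual
    heavyForks-bound : ∀ S → Acc _<_ (size S) → ∀ L → Unique L → All (HeavyFork m S) L →
                       length L * m + m ⊓ length S ≤ length S
    heavyForks-bound S ac L u forks with length-dropRoot u forks
    ... | inj₁ eq = subst (λ ℓ → ℓ * m + m ⊓ length S ≤ length S) (sym eq)
      (rootless-bound S ac (dropRoot L) (Unique.filter⁺ _ u) (all-filter _ L) (Allₚ.filter⁺ _ forks))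
    ... | inj₂ ((a , b , a≢b , ma , mb) , eq) = begin
      length L * m + m ⊓ length S  ≤⟨ +-monoʳ-≤ (length L * m) (m⊓n≤m m (length S)) ⟩
      length L * m + m             ≡⟨ cong₂ _+_ (cong (_* m) eq) refl ⟩
      suc ℓ * m + m                ≡⟨ suc-*-+ ℓ m ⟩
      ℓ * m + (m + m)
        ≡⟨ cong (ℓ * m +_) (sym (cong₂ _+_ (m≤n⇒m⊓n≡m heavy-a) (m≤n⇒m⊓n≡m heavy-b))) ⟩
      ℓ * m + (m ⊓ length (under a S) + m ⊓ length (outside a S))
        ≤⟨ split-bound a S ac occupied L′ u′ (all-filter _ L) forks′ ⟩
      length S                     ∎
      where
      open ≤-Reasoning
      L′ = dropRoot L
      u′ = Unique.filter⁺ _ u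
      forks′ = Allₚ.filter⁺ _ forks
      ℓ = length L′
      heavy-a : m ≤ length (under a S)
      heavy-a = subst (m ≤_) (≡.trans (sym (count-under a [] S)) (count-[] (under a S))) ma
      heavy-b : m ≤ length (outside a S)
      heavy-b = ≤-trans (subst (m ≤_) (sym (count-outside [] S (≢-sym a≢b))) mb)
                        (count≤length [ b ] (outside a S))
      occupied : 1 ≤ length (under a S)
      occupied = ≤-trans (>-nonZero⁻¹ m) heavy-a

    rootless-bound : ∀ S → Acc _<_ (size S) → ∀ L → Unique L → All NonEmpty L → All (HeavyFork m S) L →
                     length L * m + m ⊓ length S ≤ length S
    rootless-bound S _ [] _ _ _ = m⊓n≤n m (length S)
    rootless-bound _ _ ([] ∷ _) _ (ne ∷ _) _ = ⊥-elim (ne refl)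
    rootless-bound S ac L@((c ∷ _) ∷ _) u ne forks@(fork ∷ _) = begin
      length L * m + m ⊓ length S
        ≡⟨ cong (λ n → length L * m + m ⊓ n) (sym (length-under+outside c S)) ⟩
      length L * m + m ⊓ (length (under c S) + length (outside c S))
        ≤⟨ +-monoʳ-≤ (length L * m) (⊓-subadditive m _ _) ⟩
      length L * m + (m ⊓ length (under c S) + m ⊓ length (outside c S))
        ≤⟨ split-bound c S ac (heavy⇒occupied S fork) L u ne forks ⟩
      length S ∎
      where open ≤-Reasoning

    split-bound : ∀ c S → Acc _<_ (size S) → 1 ≤ length (under c S) →
                  ∀ L → Unique L → All NonEmpty L → All (HeavyFork m S) L →
                  length L * m + (m ⊓ length (under c S) + m ⊓ length (outside c S)) ≤ length S
    split-bound c S (acc rs) occ L u ne forks = begin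
      length L * m + (m ⊓ length Sc + m ⊓ length Sr)
        ≡⟨ cong₂ _+_ (cong (_* m) (sym (length-under+outside c L))) refl ⟩
      (length Lc + length Lr) * m + (m ⊓ length Sc + m ⊓ length Sr)
        ≡⟨ +-*-interchange (length Lc) (length Lr) m _ _ ⟩
      (length Lc * m + m ⊓ length Sc) + (length Lr * m + m ⊓ length Sr)
        ≤⟨ +-mono-≤ bound-under bound-outside ⟩
      length Sc + length Sr
        ≡⟨ length-under+outside c S ⟩
      length S ∎
      where
      open ≤-Reasoning
      Sc = under c S
      Sr = outside c S
      Lc = under c L
      Lr = outside c L
      bound-under : length Lc * m + m ⊓ length Sc ≤ length Sc
      bound-under = heavyForks-bound Sc (rs (size-under-< c S occ)) Lc (Unique-under c u)
                      (All-under c (HeavyFork-under c S) forks)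
      bound-outside : length Lr * m + m ⊓ length Sr ≤ length Sr
      bound-outside = heavyForks-bound Sr (rs (size-outside-< c S occ)) Lr (Unique-outside c u)
                        (All-outside c (HeavyFork-outside S) ne forks)

heavyForks-count : ∀ m S L → Unique L → All (HeavyFork m S) L → length L * m ≤ length S
heavyForks-count zero _ L _ _ rewrite *-zeroʳ (length L) = z≤n
heavyForks-count m@(suc _) S L u forks =
  ≤-trans (m≤m+n (length L * m) (m ⊓ length S)) (heavyForks-bound m S (<-wellFounded (size S)) L u forks)

data PrefixOrFork (u v : Word) : Set where
  u⊑v     : u ⊑ v → PrefixOrFork u v
  v⊑u     : v ⊑ u → PrefixOrFork u v
  diverge : ∀ w c d u′ v′ → c ≢ d → u ≡ w ++ c ∷ u′ → v ≡ w ++ d ∷ v′ → PrefixOrFork u v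

prefixOrFork : ∀ u v → PrefixOrFork u v
prefixOrFork []      v       = u⊑v []
prefixOrFork (c ∷ u) []      = v⊑u []
prefixOrFork (c ∷ u) (d ∷ v) with c ≟c d
... | no c≢d = diverge [] c d u v c≢d refl refl
... | yes refl with prefixOrFork u v
...   | u⊑v p = u⊑v (refl ∷ p)
...   | v⊑u p = v⊑u (refl ∷ p)
...   | diverge w c′ d′ u′ v′ c′≢d′ refl refl = diverge (c ∷ w) c′ d′ u′ v′ c′≢d′ refl refl

IsLocus-prefix : ∀ {T p q} → IsLocus T q → p ⊑ q → IsLocus T p
IsLocus-prefix l p⊑q = Any.map (⊑-trans p⊑q) l

IsNode⇒IsLocus : ∀ {T y} → NonEmpty y → IsNode T y → IsLocus T y
IsNode⇒IsLocus ne (inj₁ y≡[])                          = ⊥-elim (ne y≡[])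
IsNode⇒IsLocus _  (inj₂ (inj₁ y∈))                     = Any.map (λ { refl → ⊑-refl }) y∈
IsNode⇒IsLocus _  (inj₂ (inj₂ (a , _ , _ , la , _))) = IsLocus-prefix la (x⊑x++y _ [ a ])

⊑⇒++ : {x y : Word} → x ⊑ y → ∃ λ r → y ≡ x ++ r
⊑⇒++ {y = y} []    = y , refl
⊑⇒++ (refl ∷ x⊑y) = Product.map₂ (cong (_ ∷_)) (⊑⇒++ x⊑y)

IsChild⇒extends : ∀ {T x y} → IsChild T x y → ∃₂ λ a y′ → y ≡ x ++ a ∷ y′
IsChild⇒extends {x = x} (_ , _ , x⊑y , x≢y , _) with ⊑⇒++ x⊑y
... | []     , y≡x++[] = ⊥-elim (x≢y (sym (≡.trans y≡x++[] (List.++-identityʳ x))))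
... | a ∷ y′ , y≡x++r  = a , y′ , y≡x++r

divergence-IsNode : ∀ {T} w {c d u′ v′} → c ≢ d →
                    IsNode T (w ++ c ∷ u′) → IsNode T (w ++ d ∷ v′) → IsNode T w
divergence-IsNode {T} w {c} {d} c≢d node-c node-d =
  inj₂ (inj₂ (c , d , c≢d , locus-below node-c , locus-below node-d))
  where
  locus-below : ∀ {e r} → IsNode T (w ++ e ∷ r) → IsLocus T (w ++ [ e ])
  locus-below {e} {r} node =
    IsLocus-prefix (IsNode⇒IsLocus (++-∷-nonEmpty w e r) node) (++⁺-⊑ w (refl ∷ []))

children-same-head : ∀ {T} x a y′ z′ → IsChild T x (x ++ a ∷ y′) → IsChild T x (x ++ a ∷ z′) →
                     x ++ a ∷ y′ ≡ x ++ a ∷ z′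
children-same-head {T} x a y′ z′ (_ , node-y , _ , _ , between-y) (_ , node-z , _ , _ , between-z)
  with prefixOrFork y′ z′
... | u⊑v y′⊑z′ =
  [ ⊥-elim ∘ ++-∷-≢ x a y′ , id ]′ (between-z _ node-y (x⊑x++y x _) (++⁺-⊑ x (refl ∷ y′⊑z′)))
... | v⊑u z′⊑y′ =
  sym ([ ⊥-elim ∘ ++-∷-≢ x a z′ , id ]′ (between-y _ node-z (x⊑x++y x _) (++⁺-⊑ x (refl ∷ z′⊑y′))))
... | diverge w c d u′ v′ c≢d refl refl =
  ⊥-elim ([ ++-∷-≢ x a w , w₀≢y ]′ (between-y w₀ fork (x⊑x++y x _) (++⁺-⊑ x (refl ∷ x⊑x++y w _))))
  where
  w₀ = x ++ a ∷ w
  reassoc : ∀ {e r} → IsNode T (x ++ a ∷ w ++ e ∷ r) → IsNode T (w₀ ++ e ∷ r)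
  reassoc {e} {r} = subst (IsNode T) (sym (List.++-assoc x (a ∷ w) (e ∷ r)))
  fork : IsNode T w₀
  fork = divergence-IsNode w₀ c≢d (reassoc node-y) (reassoc node-z)
  w₀≢y : w₀ ≢ x ++ a ∷ w ++ c ∷ u′
  w₀≢y eq = ++-∷-≢ w c u′ (sym (∷-injectiveʳ (++-cancelˡ x _ _ eq)))

IsBranchingPNode⇒HeavyFork : ∀ {T x} → IsBranchingPNode T x → HeavyFork (sigma T ⊔ pi T) (encSuffixes T) x
IsBranchingPNode⇒HeavyFork {T} {x} (_ , y , z , y≢z , child-y , child-z , (_ , heavy-y) , (_ , heavy-z))
  with IsChild⇒extends child-y | IsChild⇒extends child-z
... | a , y′ , refl | b , z′ , refl =
  a , b , a≢b , ≤-trans heavy-y (count-antitone (encSuffixes T) (++⁺-⊑ x (refl ∷ [])))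
              , ≤-trans heavy-z (count-antitone (encSuffixes T) (++⁺-⊑ x (refl ∷ [])))
  where
  a≢b : a ≢ b
  a≢b refl = y≢z (children-same-head x a y′ z′ child-y child-z)

length-encSuffixes : ∀ T → length (encSuffixes T) ≡ length T
length-encSuffixes T = ≡.trans (length-map (encSuffix T) (upTo (length T))) (length-upTo (length T))

branchingPNodes-bound : ∀ T L → Unique L → All (IsBranchingPNode T) L →
                        length L * (sigma T + pi T) ≤ 2 * length T
branchingPNodes-bound T L u branching = begin
  length L * (sigma T + pi T)  ≤⟨ *-monoʳ-≤ (length L) (+-mono-≤ (m≤m⊔n σ π) (m≤n⊔m σ π)) ⟩
  length L * (M + M)           ≡⟨ *-distribˡ-+ (length L) M M ⟩
  length L * M + length L * M  ≤⟨ +-mono-≤ count-bound count-bound ⟩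
  length T + length T          ≡⟨ cong (length T +_) (sym (+-identityʳ (length T))) ⟩
  2 * length T                 ∎
  where
  open ≤-Reasoning
  σ = sigma T
  π = pi T
  M = σ ⊔ π
  count-bound : length L * M ≤ length T
  count-bound = subst (length L * M ≤_) (length-encSuffixes T)
    (heavyForks-count M (encSuffixes T) L u (All.map IsBranchingPNode⇒HeavyFork branching))

mainTheorem1 : ∃ λ (c : ℕ) →
    ∀ (w : PString) (d : ℕ) →
    inj₁ d ∉ w →
    (∀ s → inj₁ s ∈ w → s < d) →
    ∀ (L : List (List PChar)) →
    Unique L →
    All (IsBranchingPNode (w ++ [ inj₁ d ])) L →
    length L * (sigma (w ++ [ inj₁ d ]) + pi (w ++ [ inj₁ d ])) ≤ c * length (w ++ [ inj₁ d ])
mainTheorem1 = 2 , λ w d _ _ L → branchingPNodes-bound (w ++ [ inj₁ d ]) L
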